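{- For any integers $n \ge d \ge 1$ and $m \ge 1$, $$P(n+m,d) \ge P(n+m,m,d)\cdot P(n,d).$$
   Context: The Chebyshev distance between two integer sequences $\sigma,\pi$ of the same length is $\max_i|\sigma(i)-\pi(i)|$ over positions $i$. $P(n,d)$ is the maximum cardinality of a set of permutations of $\{1,\dots,n\}$ (sequences listing each element exactly once) in which any two distinct members have Chebyshev distance at least $d$. $P(N,m,d)$ is the maximum cardinality of a set $A$ of length-$m$ sequences of pairwise distinct symbols from $\{1,\dots,N\}$ such that any two distinct members of $A$ have Chebyshev distance at least $d$. -}

module Defs where

open import Data.Nat using (ℕ; zero; suc; _≤_; _⊔_; ∣_-_∣)
open import Data.Fin using (Fin; toℕ)
open import Data.Vec using (Vec; []; _∷_)
open import Data.Vec.Membership.Propositional using () renaming (_∈_ to _∈ᵥ_)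
open import Data.Vec.Relation.Unary.Unique.Propositional using () renaming (Unique to UniqueV)
open import Data.List using (List; length)
open import Data.List.Membership.Propositional using (_∈_)
open import Data.List.Relation.Unary.Unique.Propositional using (Unique)
open import Data.Product using (Σ; _×_)
open import Relation.Binary.PropositionalEquality using (_≡_; _≢_)

-- Sequences of length m over an N-symbol alphabet are Vec (Fin N) m
-- (symbol k+1 is represented by the Fin element with toℕ = k; this shift
-- does not affect differences).

cheb : ∀ {N m} → Vec (Fin N) m → Vec (Fin N) m → ℕ
cheb [] [] = 0
cheb (x ∷ xs) (y ∷ ys) = ∣ toℕ x - toℕ y ∣ ⊔ cheb xs ys

IsPerm : ∀ {n} → Vec (Fin n) n → Set
IsPerm {n} v = UniqueV v × (∀ (x : Fin n) → x ∈ᵥ v)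

IsInjSeq : ∀ {N m} → Vec (Fin N) m → Set
IsInjSeq v = UniqueV v

IsCode : ∀ {N m} → (Vec (Fin N) m → Set) → ℕ → List (Vec (Fin N) m) → Set
IsCode Ok d A =
  Unique A × (∀ σ → σ ∈ A → Ok σ)
  × (∀ σ π → σ ∈ A → π ∈ A → σ ≢ π → d ≤ cheb σ π)

IsMaxCard : ∀ {N m} → (Vec (Fin N) m → Set) → ℕ → ℕ → Set
IsMaxCard {N} {m} Ok d k =
  Σ (List (Vec (Fin N) m)) (λ A → IsCode Ok d A × length A ≡ k)
  × (∀ (A : List (Vec (Fin N) m)) → IsCode Ok d A → length A ≤ k)

-- IsP n d k  :  k = P(n,d)
IsP : ℕ → ℕ → ℕ → Set
IsP n d k = IsMaxCard {n} {n} IsPerm d k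

-- IsPSeq N m d k  :  k = P(N,m,d)
IsPSeq : ℕ → ℕ → ℕ → ℕ → Set
IsPSeq N m d k = IsMaxCard {N} {m} IsInjSeq d k

module Submission where

open import Defs
open import Data.Nat using (ℕ; _+_; _*_; _≤_)
open import Data.Nat as ℕ using (_∸_; ∣_-_∣; z≤n)
open import Data.Nat.Properties
open import Data.Fin as F using (Fin; toℕ; cast; splitAt; join; _↑ˡ_)
import Data.Fin.Properties as FP
open import Data.Vec as V using (Vec; []; _∷_; _++_)
import Data.Vec.Properties as VP
import Data.Vec.Relation.Unary.Any as VAny
import Data.Vec.Relation.Unary.Any.Properties as VAnyP
import Data.Vec.Relation.Unary.All as VAll
import Data.Vec.Relation.Unary.All.Properties as VAllP
import Data.Vec.Relation.Unary.AllPairs.Properties as VAPP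
import Data.Vec.Membership.Propositional.Properties as VMP
open import Data.Vec.Membership.Propositional using () renaming (_∈_ to _∈ᵥ_; _∉_ to _∉ᵥ_)
open import Data.Vec.Relation.Unary.Unique.Propositional using () renaming (Unique to UniqueV)
import Data.Vec.Relation.Unary.Unique.Propositional.Properties as VUP
open import Data.List as L using (List; length; filter; allFin; cartesianProductWith)
import Data.List.Properties as LP
open import Data.List.Membership.Propositional using (_∈_)
import Data.List.Membership.Propositional.Properties as LMP
import Data.List.Relation.Unary.Any as LAny
import Data.List.Relation.Unary.Any.Properties as LAnyP
import Data.List.Relation.Unary.All as LAll
import Data.List.Relation.Unary.AllPairs as LAP
import Data.List.Relation.Unary.AllPairs.Properties as LAPP
import Data.List.Relation.Unary.Unique.Propositional.Properties as LUP
open import Data.Product using (∃; _×_; _,_; proj₂)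
open import Data.Sum using (_⊎_; inj₁; inj₂; [_,_]′)
open import Function using (_∘_; id)
open import Function.Definitions using (Injective)
open import Relation.Nullary using (Dec; yes; no; ¬?; contradiction)
open import Relation.Binary.PropositionalEquality

-- A permutation β of {1..n} and an injective sequence α of length m over
-- {1..n+m} combine into the permutation (c ∘ β) ++ α of {1..n+m}, where c is
-- the increasing enumeration of the n symbols missing from α.  Since c is
-- increasing it does not shrink distances, so two such permutations are at
-- distance ≥ d: through their tails if the α's differ, and through their
-- heads otherwise.  This yields a code of size P(n+m,m,d) · P(n,d).

Expanding : ∀ {k N} → (Fin k → Fin N) → Set
Expanding f = ∀ i j → ∣ toℕ i - toℕ j ∣ ≤ ∣ toℕ (f i) - toℕ (f j) ∣

expanding⇒injective : ∀ {k N} {f : Fin k → Fin N} → Expanding f → Injective _≡_ _≡_ f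
expanding⇒injective {f = f} f-exp {i} {j} fi≡fj =
  FP.toℕ-injective (∣m-n∣≡0⇒m≡n (n≤0⇒n≡0 (begin
    ∣ toℕ i - toℕ j ∣         ≤⟨ f-exp i j ⟩
    ∣ toℕ (f i) - toℕ (f j) ∣ ≡⟨ cong (λ y → ∣ toℕ (f i) - toℕ y ∣) (sym fi≡fj) ⟩
    ∣ toℕ (f i) - toℕ (f i) ∣ ≡⟨ ∣n-n∣≡0 (toℕ (f i)) ⟩
    0                         ∎)))
  where open ≤-Reasoning

cheb-map-expanding : ∀ {N M k} {f : Fin N → Fin M} → Expanding f →
  (xs ys : Vec (Fin N) k) → cheb xs ys ≤ cheb (V.map f xs) (V.map f ys)
cheb-map-expanding f-exp [] [] = z≤n
cheb-map-expanding f-exp (x ∷ xs) (y ∷ ys) = ⊔-mono-≤ (f-exp x y) (cheb-map-expanding f-exp xs ys)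

cheb≤cheb-++ˡ : ∀ {N a b} (xs ys : Vec (Fin N) a) (zs ws : Vec (Fin N) b) →
  cheb xs ys ≤ cheb (xs ++ zs) (ys ++ ws)
cheb≤cheb-++ˡ [] [] zs ws = z≤n
cheb≤cheb-++ˡ (x ∷ xs) (y ∷ ys) zs ws =
  ⊔-monoʳ-≤ ∣ toℕ x - toℕ y ∣ (cheb≤cheb-++ˡ xs ys zs ws)

cheb≤cheb-++ʳ : ∀ {N a b} (xs ys : Vec (Fin N) a) (zs ws : Vec (Fin N) b) →
  cheb zs ws ≤ cheb (xs ++ zs) (ys ++ ws)
cheb≤cheb-++ʳ [] [] zs ws = ≤-refl
cheb≤cheb-++ʳ (x ∷ xs) (y ∷ ys) zs ws =
  ≤-trans (cheb≤cheb-++ʳ xs ys zs ws) (m≤n⊔m ∣ toℕ x - toℕ y ∣ (cheb (xs ++ zs) (ys ++ ws)))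

retraction⇒injective : ∀ {A B : Set} {f : A → B} (g : B → A) → (∀ x → g (f x) ≡ x) →
  Injective _≡_ _≡_ f
retraction⇒injective {f = f} g g∘f≗id {x} {y} fx≡fy = begin
  x         ≡⟨ g∘f≗id x ⟨
  g (f x)   ≡⟨ cong g fx≡fy ⟩
  g (f y)   ≡⟨ g∘f≗id y ⟩
  y         ∎
  where open ≡-Reasoning

splitAt-injective : ∀ k {l} → Injective _≡_ _≡_ (splitAt k {l})
splitAt-injective k {l} = retraction⇒injective (join k l) (FP.join-splitAt k l)

join-injective : ∀ k l → Injective _≡_ _≡_ (join k l)
join-injective k l = retraction⇒injective (splitAt k) (FP.splitAt-join k l)

gap⇒∣-∣≤ : ∀ {a b x y} → a ≤ b → (b ∸ a) + x ≤ y → ∣ a - b ∣ ≤ ∣ x - y ∣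
gap⇒∣-∣≤ {a} {b} {x} {y} a≤b gap
  rewrite m≤n⇒∣m-n∣≡n∸m a≤b | m≤n⇒∣m-n∣≡n∸m (m+n≤o⇒n≤o (b ∸ a) gap) =
  m+n≤o⇒m≤o∸n (b ∸ a) gap

lookup-gap : ∀ {N} (xs : List (Fin N)) → LAP.AllPairs F._<_ xs →
  ∀ (i j : Fin (length xs)) → toℕ i ≤ toℕ j →
  (toℕ j ∸ toℕ i) + toℕ (L.lookup xs i) ≤ toℕ (L.lookup xs j)
lookup-gap (x L.∷ xs) _ F.zero F.zero _ = ≤-refl
lookup-gap (x L.∷ y L.∷ ys) ((x<y LAll.∷ _) LAP.∷ y∷ys↑) F.zero (F.suc j) _ = begin
  ℕ.suc (toℕ j) + toℕ x ≡⟨ +-suc (toℕ j) (toℕ x) ⟨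
  toℕ j + ℕ.suc (toℕ x) ≤⟨ +-monoʳ-≤ (toℕ j) x<y ⟩
  toℕ j + toℕ y         ≤⟨ lookup-gap (y L.∷ ys) y∷ys↑ F.zero j z≤n ⟩
  toℕ (L.lookup (y L.∷ ys) j) ∎
  where open ≤-Reasoning
lookup-gap (x L.∷ xs) (_ LAP.∷ xs↑) (F.suc i) (F.suc j) (ℕ.s≤s i≤j) = lookup-gap xs xs↑ i j i≤j

lookup-expanding : ∀ {N} (xs : List (Fin N)) → LAP.AllPairs F._<_ xs → Expanding (L.lookup xs)
lookup-expanding xs xs↑ i j with ≤-total (toℕ i) (toℕ j)
... | inj₁ i≤j = gap⇒∣-∣≤ i≤j (lookup-gap xs xs↑ i j i≤j)
... | inj₂ j≤i
  rewrite ∣-∣-comm (toℕ i) (toℕ j) | ∣-∣-comm (toℕ (L.lookup xs i)) (toℕ (L.lookup xs j)) =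
  gap⇒∣-∣≤ j≤i (lookup-gap xs xs↑ j i j≤i)

module Complement {n m : ℕ} (α : Vec (Fin (n + m)) m) where

  ∉α? : (x : Fin (n + m)) → Dec (x ∉ᵥ α)
  ∉α? x = ¬? (VAny.any? (x F.≟_) α)

  rest : List (Fin (n + m))
  rest = filter ∉α? (allFin (n + m))

  rest-increasing : LAP.AllPairs F._<_ rest
  rest-increasing = LAPP.filter⁺ ∉α? (LAPP.tabulate⁺-< id)

  ∈rest⇒∉α : ∀ {x} → x ∈ rest → x ∉ᵥ α
  ∈rest⇒∉α x∈ = proj₂ (LMP.∈-filter⁻ ∉α? {xs = allFin (n + m)} x∈)

  ∉α⇒∈rest : ∀ {x} → x ∉ᵥ α → x ∈ rest
  ∉α⇒∈rest x∉ = LMP.∈-filter⁺ ∉α? (LMP.∈-allFin _) x∉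

  -- The second branch is unreachable for injective α (see length-rest); it
  -- only makes embed total, so that extend needs no injectivity proof.
  embed : Fin n → Fin (n + m)
  embed with n ℕ.≟ length rest
  ... | yes n≡ = L.lookup rest ∘ cast n≡
  ... | no _ = _↑ˡ m

  embed-injective : Injective _≡_ _≡_ embed
  embed-injective with n ℕ.≟ length rest
  ... | yes n≡ = retraction⇒injective (cast (sym n≡)) (FP.cast-involutive (sym n≡) n≡)
                 ∘ expanding⇒injective {f = L.lookup rest} (lookup-expanding rest rest-increasing)
  ... | no _ = FP.↑ˡ-injective m _ _

  module _ (α! : UniqueV α) where

    fromSplit : Fin (length rest) ⊎ Fin m → Fin (n + m)
    fromSplit = [ L.lookup rest , V.lookup α ]′

    fromSplit-injective : Injective _≡_ _≡_ fromSplit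
    fromSplit-injective {inj₁ i} {inj₁ j} eq =
      cong inj₁ (expanding⇒injective (lookup-expanding rest rest-increasing) eq)
    fromSplit-injective {inj₂ i} {inj₂ j} eq = cong inj₂ (VUP.lookup-injective α! i j eq)
    fromSplit-injective {inj₁ i} {inj₂ j} eq =
      contradiction (subst (_∈ᵥ α) (sym eq) (VMP.∈-lookup j α)) (∈rest⇒∉α (LMP.∈-lookup i))
    fromSplit-injective {inj₂ i} {inj₁ j} eq =
      contradiction (subst (_∈ᵥ α) eq (VMP.∈-lookup i α)) (∈rest⇒∉α (LMP.∈-lookup j))

    toSplit : Fin (n + m) → Fin (length rest) ⊎ Fin m
    toSplit x with VAny.any? (x F.≟_) α
    ... | yes x∈ = inj₂ (VAny.index x∈)
    ... | no x∉ = inj₁ (LAny.index (∉α⇒∈rest x∉))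

    fromSplit-toSplit : ∀ x → fromSplit (toSplit x) ≡ x
    fromSplit-toSplit x with VAny.any? (x F.≟_) α
    ... | yes x∈ = sym (VAnyP.lookup-index x∈)
    ... | no x∉ = sym (LAnyP.lookup-index (∉α⇒∈rest x∉))

    length-rest : length rest ≡ n
    length-rest = +-cancelʳ-≡ m (length rest) n (FP.cantor-schröder-bernstein
      {f = fromSplit ∘ splitAt (length rest)} {g = join (length rest) m ∘ toSplit}
      (splitAt-injective (length rest) ∘ fromSplit-injective)
      (retraction⇒injective {f = toSplit} fromSplit fromSplit-toSplit ∘ join-injective (length rest) m))

    embed≡lookup : ∀ j → embed j ≡ L.lookup rest (cast (sym length-rest) j)
    embed≡lookup j with n ℕ.≟ length rest
    ... | yes _ = refl
    ... | no n≢ = contradiction (sym length-rest) n≢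

    embed-expanding : Expanding embed
    embed-expanding i j = begin
      ∣ toℕ i - toℕ j ∣                     ≡⟨ cong₂ ∣_-_∣ (FP.toℕ-cast _ i) (FP.toℕ-cast _ j) ⟨
      ∣ toℕ (cast _ i) - toℕ (cast _ j) ∣   ≤⟨ lookup-expanding rest rest-increasing _ _ ⟩
      ∣ toℕ (L.lookup rest (cast _ i)) - toℕ (L.lookup rest (cast _ j)) ∣
        ≡⟨ cong₂ (λ x y → ∣ toℕ x - toℕ y ∣) (embed≡lookup i) (embed≡lookup j) ⟨
      ∣ toℕ (embed i) - toℕ (embed j) ∣     ∎
      where open ≤-Reasoning

    embed-∉α : ∀ j → embed j ∉ᵥ α
    embed-∉α j rewrite embed≡lookup j = ∈rest⇒∉α (LMP.∈-lookup _)

    embed-onto : ∀ {x} → x ∉ᵥ α → ∃ λ j → embed j ≡ x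
    embed-onto {x} x∉ = cast length-rest k , (begin
      embed (cast length-rest k)                                  ≡⟨ embed≡lookup _ ⟩
      L.lookup rest (cast (sym length-rest) (cast length-rest k))
        ≡⟨ cong (L.lookup rest) (FP.cast-involutive (sym length-rest) length-rest k) ⟩
      L.lookup rest k                                             ≡⟨ LAnyP.lookup-index (∉α⇒∈rest x∉) ⟨
      x                                                           ∎)
      where open ≡-Reasoning
            k = LAny.index (∉α⇒∈rest x∉)

∉⇒All≢ : ∀ {A : Set} {k} {x : A} (xs : Vec A k) → x ∉ᵥ xs → VAll.All (x ≢_) xs
∉⇒All≢ [] _ = VAll.[]
∉⇒All≢ (y ∷ ys) x∉ = (x∉ ∘ VAny.here) VAll.∷ ∉⇒All≢ ys (x∉ ∘ VAny.there)

map-injective : ∀ {A B : Set} {k} {f : A → B} → Injective _≡_ _≡_ f →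
  Injective _≡_ _≡_ (V.map {n = k} f)
map-injective f-inj {[]} {[]} _ = refl
map-injective f-inj {x ∷ xs} {y ∷ ys} eq =
  cong₂ _∷_ (f-inj (VP.∷-injectiveˡ eq)) (map-injective f-inj (VP.∷-injectiveʳ eq))

open Complement using (embed; embed-injective; embed-expanding; embed-∉α; embed-onto)

extend : ∀ {n m} → Vec (Fin (n + m)) m → Vec (Fin n) n → Vec (Fin (n + m)) (n + m)
extend α β = V.map (embed α) β ++ α

extend-isPerm : ∀ {n m} {α : Vec (Fin (n + m)) m} {β : Vec (Fin n) n} →
  IsInjSeq α → IsPerm β → IsPerm (extend α β)
extend-isPerm {α = α} {β} α! (β! , β-onto) =
  VAPP.++⁺ (VUP.map⁺ (embed-injective α) β!) α!
    (VAllP.map⁺ (VAll.universal (λ j → ∉⇒All≢ α (embed-∉α α α! j)) β)) ,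
  member
  where
    member : ∀ x → x ∈ᵥ extend α β
    member x with VAny.any? (x F.≟_) α
    ... | yes x∈α = VMP.∈-++⁺ʳ (V.map (embed α) β) x∈α
    ... | no x∉α with embed-onto α α! x∉α
    ...   | j , refl = VMP.∈-++⁺ˡ (VMP.∈-map⁺ (embed α) (β-onto j))

extend-injective : ∀ {n m} {α α' : Vec (Fin (n + m)) m} {β β' : Vec (Fin n) n} →
  extend α β ≡ extend α' β' → α ≡ α' × β ≡ β'
extend-injective {α = α} {α'} {β} {β'} eq
  with VP.++-injectiveʳ (V.map (embed α) β) (V.map (embed α') β') eq
... | refl = refl , map-injective (embed-injective α) (VP.++-injectiveˡ (V.map (embed α) β) _ eq)

cheb-extend-sameTail : ∀ {n m} {α : Vec (Fin (n + m)) m} → IsInjSeq α → (β β' : Vec (Fin n) n) →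
  cheb β β' ≤ cheb (extend α β) (extend α β')
cheb-extend-sameTail {α = α} α! β β' =
  ≤-trans (cheb-map-expanding {f = embed α} (embed-expanding α α!) β β')
          (cheb≤cheb-++ˡ (V.map (embed α) β) (V.map (embed α) β') α α)

cheb-extend-tail : ∀ {n m} (α α' : Vec (Fin (n + m)) m) (β β' : Vec (Fin n) n) →
  cheb α α' ≤ cheb (extend α β) (extend α' β')
cheb-extend-tail α α' β β' = cheb≤cheb-++ʳ (V.map (embed α) β) (V.map (embed α') β') α α'

length-cartesianProductWith : ∀ {A B C : Set} (f : A → B → C) (xs : List A) (ys : List B) →
  length (cartesianProductWith f xs ys) ≡ length xs * length ys
length-cartesianProductWith f L.[] ys = refl
length-cartesianProductWith f (x L.∷ xs) ys = begin
  length (L.map (f x) ys L.++ cartesianProductWith f xs ys)    ≡⟨ LP.length-++ (L.map (f x) ys) ⟩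
  length (L.map (f x) ys) + length (cartesianProductWith f xs ys)
    ≡⟨ cong₂ _+_ (LP.length-map (f x) ys) (length-cartesianProductWith f xs ys) ⟩
  length ys + length xs * length ys                            ∎
  where open ≡-Reasoning

extend-isCode : ∀ {n m d} {A : List (Vec (Fin (n + m)) m)} {B : List (Vec (Fin n) n)} →
  IsCode IsInjSeq d A → IsCode IsPerm d B → IsCode IsPerm d (cartesianProductWith extend A B)
extend-isCode {d = d} {A = A} {B} (A! , A-inj , A-dist) (B! , B-perm , B-dist) =
  LUP.cartesianProductWith⁺ extend extend-injective A! B! , isPerm , dist
  where
    isPerm : ∀ σ → σ ∈ cartesianProductWith extend A B → IsPerm σ
    isPerm σ σ∈ with α , β , α∈ , β∈ , refl ← LMP.∈-cartesianProductWith⁻ extend A B σ∈ =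
      extend-isPerm (A-inj α α∈) (B-perm β β∈)

    dist : ∀ σ π → σ ∈ cartesianProductWith extend A B → π ∈ cartesianProductWith extend A B →
      σ ≢ π → d ≤ cheb σ π
    dist σ π σ∈ π∈ σ≢π
      with α , β , α∈ , β∈ , refl ← LMP.∈-cartesianProductWith⁻ extend A B σ∈
         | α' , β' , α'∈ , β'∈ , refl ← LMP.∈-cartesianProductWith⁻ extend A B π∈
      with VP.≡-dec F._≟_ α α'
    ... | yes refl = ≤-trans (B-dist β β' β∈ β'∈ (σ≢π ∘ cong (extend α)))
                       (cheb-extend-sameTail (A-inj α α∈) β β')
    ... | no α≢α' = ≤-trans (A-dist α α' α∈ α'∈ α≢α') (cheb-extend-tail α α' β β')

corollary1 : ∀ (n m d : ℕ) → 1 ≤ d → d ≤ n → 1 ≤ m →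
    ∀ (a b c : ℕ) → IsP (n + m) d c → IsPSeq (n + m) m d a → IsP n d b →
    a * b ≤ c
corollary1 n m d _ _ _ a b c (_ , maximal) ((A , A-code , refl) , _) ((B , B-code , refl) , _) =
  subst (_≤ c) (length-cartesianProductWith extend A B) (maximal _ (extend-isCode A-code B-code))
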